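{- Let $A$ be an irreducible $N\times N$ max-plus matrix whose graph $G=G(A)$ contains at least one edge, and let $\gamma(G)$ and $ep(G)$ be the cyclicity and exploration penalty of $G$. For any nodes $i,j$ and any integer $n\ge ep(G)+\gamma(G)+N-2$, there exists a walk $W$ from $i$ to $j$ with $n-\ell(W)\in\{0,\dots,\gamma(G)-1\}$.
   Context: $G(A)$ is the directed graph on $\{1,\dots,N\}$ with an edge $(i,j)$ iff $A_{i,j}\neq-\infty$; $A$ irreducible means $G(A)$ strongly connected. A walk is a finite sequence of consecutive edges, $\ell(W)$ its number of edges; a cycle is a closed walk with no nonempty closed proper subwalk. The cyclicity of a strongly connected graph is the gcd of its cycle lengths. The exploration penalty $ep(G)$ is the least integer $e$ such that for every node $i$ and every $n\ge e$ divisible by $\gamma(G)$ there is a closed walk of length $n$ starting at $i$. -}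

module Defs where

open import Data.Nat using (ℕ; zero; suc; _+_; _≤_; _<_)
open import Data.Nat.Divisibility using (_∣_)
open import Data.Fin using (Fin; zero; suc; toℕ; fromℕ; inject₁)
open import Data.Product using (Σ; ∃; _×_)
open import Relation.Binary.PropositionalEquality using (_≡_; _≢_)
open import Relation.Nullary using (¬_)

-- A max-plus matrix over an entry type R with a distinguished element -∞.
-- (For the paper R = ℝ ∪ {-∞}; only the support of A matters.)
module MaxPlusGraph {N : ℕ} {R : Set} (-∞ : R) (A : Fin N → Fin N → R) where

  Edge : Fin N → Fin N → Set
  Edge i j = A i j ≢ -∞

  HasEdge : Set
  HasEdge = Σ (Fin N) λ i → Σ (Fin N) λ j → Edge i j

  record Walk (i j : Fin N) : Set where
    field
      ℓ     : ℕ
      node  : Fin (suc ℓ) → Fin N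
      start : node zero ≡ i
      end   : node (fromℕ ℓ) ≡ j
      step  : (t : Fin ℓ) → Edge (node (inject₁ t)) (node (suc t))
  open Walk public

  IsCycle : {i : Fin N} → Walk i i → Set
  IsCycle W = (a b : Fin (suc (ℓ W))) → toℕ a < toℕ b → node W a ≡ node W b →
              toℕ a ≡ 0 × toℕ b ≡ ℓ W

  IsCycleLength : ℕ → Set
  IsCycleLength k = Σ (Fin N) λ i → Σ (Walk i i) λ W → IsCycle W × ℓ W ≡ k

  StronglyConnected : Set
  StronglyConnected = (i j : Fin N) → Walk i j

  Irreducible : Set
  Irreducible = StronglyConnected

  IsCyclicity : ℕ → Set
  IsCyclicity γ = ((k : ℕ) → IsCycleLength k → γ ∣ k) ×
                  ((d : ℕ) → ((k : ℕ) → IsCycleLength k → d ∣ k) → d ∣ γ)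

  ExploresFrom : ℕ → ℕ → Set
  ExploresFrom γ e = (i : Fin N) (n : ℕ) → e ≤ n → γ ∣ n →
                     Σ (Walk i i) λ W → ℓ W ≡ n

  IsExplorationPenalty : ℕ → ℕ → Set
  IsExplorationPenalty γ e = ExploresFrom γ e × ((e' : ℕ) → ExploresFrom γ e' → e ≤ e')

-- Cutting out repeated vertices turns the walk from i to j given by irreducibility into a
-- path of length p < N.  Prepend a closed walk at i whose length m is the largest multiple
-- of γ not exceeding n ∸ p: the bound on n forces m ≥ ep(G), so the exploration property
-- supplies it, and n ∸ (m + p) < γ.  Here γ > 0 because the closed walk through any edge
-- contains a cycle of positive length.
module Submission where

open import Defs
open import Data.Nat using (ℕ; _+_; _≤_; _<_; _∸_)
open import Data.Fin using (Fin)
open import Data.Product using (Σ; _×_)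

open import Data.Nat using (zero; suc; z≤n; s≤s; z<s; _*_; _<?_; _⊓_; NonZero; ≢-nonZero; >-nonZero⁻¹)
open import Data.Nat.Properties
open import Data.Nat.DivMod using (_/_; m/n*n≤m; m%n<n; m%n≡m∸m/n*n)
open import Data.Nat.Divisibility using (_∣_; n∣m*n; 0∣⇒≡0)
open import Data.Nat.Induction using (<-wellFounded)
open import Induction.WellFounded using (Acc; acc)
open import Data.Fin using (zero; suc; toℕ; fromℕ; fromℕ<; inject₁) renaming (_≟_ to _≟ᶠ_)
open import Data.Fin.Properties
  using (toℕ<n; toℕ-fromℕ; toℕ-fromℕ<; toℕ-inject₁; toℕ-injective; any?; pigeonhole)
open import Data.Product using (_,_)
open import Relation.Nullary using (¬_; Dec; yes; no)
open import Relation.Nullary.Decidable using (_×-dec_; ¬?; decidable-stable)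
open import Relation.Binary.PropositionalEquality
open import Function using (_∘_)

InWindow : (γ n l : ℕ) → Set
InWindow γ n l = l ≤ n × n ∸ l < γ

largest-multiple-inWindow : ∀ γ .{{_ : NonZero γ}} e r → e + γ ≤ suc r →
                            Σ ℕ λ m → γ ∣ m × e ≤ m × InWindow γ r m
largest-multiple-inWindow γ e r e+γ≤1+r = m , n∣m*n (r / γ) , e≤m , m≤r , r∸m<γ
  where
    open ≤-Reasoning
    m = r / γ * γ
    m≤r : m ≤ r
    m≤r = m/n*n≤m r γ
    r∸m<γ : r ∸ m < γ
    r∸m<γ = subst (_< γ) (m%n≡m∸m/n*n r γ) (m%n<n r γ)
    e≤m : e ≤ m
    e≤m = +-cancelʳ-≤ γ e m (begin
      e + γ           ≤⟨ e+γ≤1+r ⟩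
      suc r           ≡⟨ cong suc (m∸n+n≡m m≤r) ⟨
      suc (r ∸ m) + m ≤⟨ +-monoˡ-≤ m r∸m<γ ⟩
      γ + m           ≡⟨ +-comm γ m ⟩
      m + γ           ∎)

length-budget : ∀ {γ e N n p} .{{_ : NonZero γ}} → e + γ + N ≤ n + 2 → p < N →
                Σ ℕ λ m → γ ∣ m × e ≤ m × InWindow γ n (m + p)
length-budget {γ} {e} {N} {n} {p} bound p<N =
  let (m , γ∣m , e≤m , m≤n∸p , n∸p∸m<γ) = largest-multiple-inWindow γ e (n ∸ p) e+γ≤1+[n∸p]
  in  m , γ∣m , e≤m , m≤o∸n⇒m+n≤o m p≤n m≤n∸p
    , subst (_< γ) (trans (∸-+-assoc n p m) (cong (n ∸_) (+-comm p m))) n∸p∸m<γ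
  where
    open ≤-Reasoning
    e+γ+p≤1+n : e + γ + p ≤ suc n
    e+γ+p≤1+n = ≤-pred (begin
      suc (e + γ + p) ≡⟨ +-suc (e + γ) p ⟨
      e + γ + suc p   ≤⟨ +-monoʳ-≤ (e + γ) p<N ⟩
      e + γ + N       ≤⟨ bound ⟩
      n + 2           ≡⟨ +-comm n 2 ⟩
      suc (suc n)     ∎)
    p≤n : p ≤ n
    p≤n = ≤-pred (begin-strict
      p           <⟨ m<n+m p (>-nonZero⁻¹ γ) ⟩
      γ + p       ≤⟨ m≤n+m (γ + p) e ⟩
      e + (γ + p) ≡⟨ +-assoc e γ p ⟨
      e + γ + p   ≤⟨ e+γ+p≤1+n ⟩
      suc n       ∎)
    e+γ≤1+[n∸p] : e + γ ≤ suc (n ∸ p)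
    e+γ≤1+[n∸p] = subst (e + γ ≤_) (+-∸-assoc 1 p≤n) (m+n≤o⇒m≤o∸n (e + γ) e+γ+p≤1+n)

clamp : ∀ ℓ → ℕ → Fin (suc ℓ)
clamp ℓ t = fromℕ< (s≤s (m⊓n≤n t ℓ))

clamp-toℕ : ∀ {ℓ t} (a : Fin (suc ℓ)) → toℕ a ≡ t → clamp ℓ t ≡ a
clamp-toℕ a refl = toℕ-injective (trans (toℕ-fromℕ< _) (m≤n⇒m⊓n≡m (≤-pred (toℕ<n a))))

-- f on positions 0 … l, followed by g shifted to start at position l
splice : {X : Set} → ℕ → (ℕ → X) → (ℕ → X) → ℕ → X
splice zero    f g t       = g t
splice (suc l) f g zero    = f 0
splice (suc l) f g (suc t) = splice l (f ∘ suc) g t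

splice-≤ : ∀ {X : Set} l (f g : ℕ → X) → f l ≡ g 0 → ∀ {t} → t ≤ l → splice l f g t ≡ f t
splice-≤ zero    f g meet z≤n       = sym meet
splice-≤ (suc l) f g meet z≤n       = refl
splice-≤ (suc l) f g meet (s≤s t≤l) = splice-≤ l (f ∘ suc) g meet t≤l

splice-+ : ∀ {X : Set} l (f g : ℕ → X) s → splice l f g (l + s) ≡ g s
splice-+ zero    f g s = refl
splice-+ (suc l) f g s = splice-+ l (f ∘ suc) g s

module Walks {N : ℕ} {R : Set} (-∞ : R) (A : Fin N → Fin N → R) where
  open MaxPlusGraph -∞ A

  private variable
    i j k v i′ j′ : Fin N

  -- Vertices indexed by all of ℕ (arbitrary past the end), so that walks are cut and
  -- concatenated without casts between Fin types.
  record Walkℕ (i j : Fin N) : Set where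
    field
      length : ℕ
      vertex : ℕ → Fin N
      begins : vertex 0 ≡ i
      ends   : vertex length ≡ j
      steps  : ∀ t → t < length → Edge (vertex t) (vertex (suc t))
  open Walkℕ

  toWalk : Walkℕ i j → Walk i j
  toWalk W = record
    { ℓ     = length W
    ; node  = vertex W ∘ toℕ
    ; start = begins W
    ; end   = trans (cong (vertex W) (toℕ-fromℕ (length W))) (ends W)
    ; step  = λ t → subst (λ s → Edge (vertex W s) (vertex W (suc (toℕ t))))
                          (sym (toℕ-inject₁ t)) (steps W (toℕ t) (toℕ<n t))
    }

  fromWalk : Walk i j → Walkℕ i j
  fromWalk W = record
    { length = ℓ W
    ; vertex = node W ∘ clamp (ℓ W)
    ; begins = trans (cong (node W) (clamp-toℕ zero refl)) (start W)
    ; ends   = trans (cong (node W) (clamp-toℕ (fromℕ (ℓ W)) (toℕ-fromℕ (ℓ W)))) (end W)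
    ; steps  = λ t t<ℓ → let u = fromℕ< t<ℓ in
        subst₂ (λ a b → Edge (node W a) (node W b))
          (sym (clamp-toℕ (inject₁ u) (trans (toℕ-inject₁ u) (toℕ-fromℕ< t<ℓ))))
          (sym (clamp-toℕ (suc u) (cong suc (toℕ-fromℕ< t<ℓ))))
          (step W u)
    }

  edgeWalk : Edge i j → Walkℕ i j
  edgeWalk {i} {j} i→j = record
    { length = 1
    ; vertex = λ { zero → i ; (suc _) → j }
    ; begins = refl
    ; ends   = refl
    ; steps  = λ { zero _ → i→j ; (suc _) (s≤s ()) }
    }

  cast : i ≡ i′ → j ≡ j′ → Walkℕ i j → Walkℕ i′ j′
  cast i≡i′ j≡j′ W = record
    { length = length W ; vertex = vertex W ; steps = steps W
    ; begins = trans (begins W) i≡i′ ; ends = trans (ends W) j≡j′ }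

  splice-steps : ∀ l m (f g : ℕ → Fin N) →
                 (∀ t → t < l → Edge (f t) (f (suc t))) → f l ≡ g 0 →
                 (∀ t → t < m → Edge (g t) (g (suc t))) →
                 ∀ t → t < l + m → Edge (splice l f g t) (splice l f g (suc t))
  splice-steps zero    m f g f-steps meet g-steps t       t<m   = g-steps t t<m
  splice-steps (suc l) m f g f-steps meet g-steps zero    _     =
    subst (Edge (f 0)) (sym (splice-≤ l (f ∘ suc) g meet z≤n)) (f-steps 0 z<s)
  splice-steps (suc l) m f g f-steps meet g-steps (suc t) (s≤s t<l+m) =
    splice-steps l m (f ∘ suc) g (λ s s<l → f-steps (suc s) (s≤s s<l)) meet g-steps t t<l+m

  infixr 5 _++_
  _++_ : Walkℕ i k → Walkℕ k j → Walkℕ i j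
  V ++ W = record
    { length = length V + length W
    ; vertex = splice (length V) (vertex V) (vertex W)
    ; begins = trans (splice-≤ (length V) (vertex V) (vertex W) meet z≤n) (begins V)
    ; ends   = trans (splice-+ (length V) (vertex V) (vertex W) (length W)) (ends W)
    ; steps  = splice-steps (length V) (length W) (vertex V) (vertex W) (steps V) meet (steps W)
    }
    where meet = trans (ends V) (sym (begins W))

  segment : (W : Walkℕ i j) {a b : ℕ} → a ≤ b → b ≤ length W →
            Walkℕ (vertex W a) (vertex W b)
  segment W {a} {b} a≤b b≤l = record
    { length = b ∸ a
    ; vertex = λ t → vertex W (a + t)
    ; begins = cong (vertex W) (+-identityʳ a)
    ; ends   = cong (vertex W) (m+[n∸m]≡n a≤b)
    ; steps  = λ t t<b∸a → subst (λ s → Edge (vertex W (a + t)) (vertex W s)) (sym (+-suc a t))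
                                 (steps W (a + t) (<-≤-trans (a+t<b t<b∸a) b≤l))
    }
    where
      a+t<b : ∀ {t} → t < b ∸ a → a + t < b
      a+t<b t<b∸a = subst (_ <_) (m+[n∸m]≡n a≤b) (+-monoʳ-< a t<b∸a)

  cutLoop : (W : Walkℕ i j) {a b : ℕ} → a < b → b ≤ length W → vertex W a ≡ vertex W b →
            Walkℕ i j
  cutLoop W a<b b≤l repeat =
    cast (begins W) (ends W) (cast refl repeat (segment W z≤n (≤-trans (<⇒≤ a<b) b≤l)) ++ segment W b≤l ≤-refl)

  cutLoop-shorter : (W : Walkℕ i j) {a b : ℕ} (a<b : a < b) (b≤l : b ≤ length W)
                    (repeat : vertex W a ≡ vertex W b) → length (cutLoop W a<b b≤l repeat) < length W
  cutLoop-shorter W {a} {b} a<b b≤l _ = begin-strict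
    a + (length W ∸ b) <⟨ +-monoˡ-< (length W ∸ b) a<b ⟩
    b + (length W ∸ b) ≡⟨ m+[n∸m]≡n b≤l ⟩
    length W           ∎
    where open ≤-Reasoning

  shortenWalk : (W : Walkℕ i j) → Acc _<_ (length W) → Σ (Walkℕ i j) λ V → length V < N
  shortenWalk W (acc shorter) with length W <? N
  ... | yes W<N = W , W<N
  ... | no W≮N with pigeonhole (s≤s (≮⇒≥ W≮N)) (vertex W ∘ toℕ)
  ...   | a , b , a<b , repeat =
          shortenWalk (cutLoop W a<b b≤l repeat) (shorter (cutLoop-shorter W a<b b≤l repeat))
    where b≤l = ≤-pred (toℕ<n b)

  PositiveCycle : Set
  PositiveCycle = Σ (Fin N) λ u → Σ (Walk u u) λ C → IsCycle C × 0 < ℓ C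

  ProperRepeat : (W : Walk i j) → Fin (suc (ℓ W)) → Fin (suc (ℓ W)) → Set
  ProperRepeat W a b = toℕ a < toℕ b × node W a ≡ node W b × ¬ (toℕ a ≡ 0 × toℕ b ≡ ℓ W)

  properRepeat? : (W : Walk i j) (a b : Fin (suc (ℓ W))) → Dec (ProperRepeat W a b)
  properRepeat? W a b =
    toℕ a <? toℕ b ×-dec node W a ≟ᶠ node W b ×-dec ¬? (toℕ a ≟ 0 ×-dec toℕ b ≟ ℓ W)

  proper-segment-shorter : ∀ {a b l} → a < b → b ≤ l → ¬ (a ≡ 0 × b ≡ l) → b ∸ a < l
  proper-segment-shorter {zero}  _   b≤l notWhole = ≤∧≢⇒< b≤l (λ b≡l → notWhole (refl , b≡l))
  proper-segment-shorter {suc a} a<b b≤l _        = <-≤-trans (∸-monoʳ-< z<s (<⇒≤ a<b)) b≤l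

  -- A positive closed walk is a cycle unless it contains a shorter positive closed subwalk.
  closedWalk⇒cycle : (W : Walkℕ v v) → 0 < length W → Acc _<_ (length W) → PositiveCycle
  closedWalk⇒cycle {v} W positive (acc shorter)
    with any? (λ a → any? (properRepeat? (toWalk W) a))
  ... | no noRepeat = v , toWalk W , isCycle , positive
    where
      isCycle : IsCycle (toWalk W)
      isCycle a b a<b same = decidable-stable (toℕ a ≟ 0 ×-dec toℕ b ≟ length W)
                               (λ notWhole → noRepeat (a , b , a<b , same , notWhole))
  ... | yes (a , b , a<b , same , notWhole) =
          closedWalk⇒cycle (cast refl (sym same) (segment W (<⇒≤ a<b) b≤l)) (m<n⇒0<n∸m a<b)
                           (shorter (proper-segment-shorter a<b b≤l notWhole))
    where b≤l = ≤-pred (toℕ<n b)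

  cyclicity-nonZero : Irreducible → HasEdge → ∀ {γ} → IsCyclicity γ → NonZero γ
  cyclicity-nonZero connected (u , w , u→w) (γ-divides , _)
    with closedWalk⇒cycle (edgeWalk u→w ++ fromWalk (connected w u)) z<s (<-wellFounded _)
  ... | c , C , isCycle , positive =
          ≢-nonZero λ { refl → <⇒≢ positive (sym (0∣⇒≡0 (γ-divides (ℓ C) (c , C , isCycle , refl)))) }

lemma6 : {N : ℕ} {R : Set} (-∞ : R) (A : Fin N → Fin N → R) →
         MaxPlusGraph.Irreducible -∞ A → MaxPlusGraph.HasEdge -∞ A →
         (γ e : ℕ) → MaxPlusGraph.IsCyclicity -∞ A γ →
         MaxPlusGraph.IsExplorationPenalty -∞ A γ e →
         (i j : Fin N) (n : ℕ) → e + γ + N ≤ n + 2 →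
         Σ (MaxPlusGraph.Walk -∞ A i j) λ W →
           MaxPlusGraph.Walk.ℓ W ≤ n × n ∸ MaxPlusGraph.Walk.ℓ W < γ
lemma6 -∞ A connected hasEdge γ e cyclicity (explores , _) i j n bound =
  let open Walks -∞ A
      (path , short) = shortenWalk (fromWalk (connected i j)) (<-wellFounded _)
      (m , γ∣m , e≤m , window) =
        length-budget {{cyclicity-nonZero connected hasEdge cyclicity}} bound short
      (loop , loop-length) = explores i m e≤m γ∣m
  in  toWalk (fromWalk loop ++ path)
    , subst (λ l → InWindow γ n (l + Walkℕ.length path)) (sym loop-length) window
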